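{- Let $G=(V,E)$ be a simple undirected graph and let $M$ be the random edge set produced by the following procedure: put each vertex into a set $I$ independently with probability $1/2$; for each $v\in I$ with at least one neighbor, choose a neighbor $u$ of $v$ uniformly at random and add the directed edge $(v,u)$ to a set $\vec{M}$ with probability $\frac{\min\{\deg_G(u),\deg_G(v)\}}{\deg_G(u)}$; finally let $M=\{\{v,u\}:(v,u)\in\vec{M},\ u\notin I,\ u\text{ has exactly one incoming edge in }\vec{M}\}$. Then $M$ is a matching and for every edge $\{u,v\}\in E$, \[\Pr[\{u,v\}\in M]\ge\frac{1}{4\max\{\deg_G(u),\deg_G(v)\}}.\]
   Context: $\deg_G(v)$ denotes the number of neighbors of $v$ in $G$. All random choices in the procedure are independent. -}

module Defs where

open import Data.Nat as ℕ using (ℕ; zero; suc; _⊔_; _⊓_)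
open import Data.Fin as Fin using (Fin; _≟_)
open import Data.List using (List; []; _∷_; map; concatMap; foldr)
open import Data.Bool using (Bool; true; false; if_then_else_; _∧_; not)
open import Data.Product using (_×_; _,_)
open import Data.Integer using (+_)
open import Data.Rational using (ℚ; 0ℚ; 1ℚ; _+_; _*_; _-_; _/_)
open import Relation.Nullary.Decidable using (⌊_⌋)
open import Relation.Binary.PropositionalEquality using (_≡_)
open import Data.Nat.ListAction using () renaming (sum to sumℕ)

record Graph : Set where
  field
    n     : ℕ
    adj   : Fin n → Fin n → Bool
    sym   : ∀ x y → adj x y ≡ adj y x
    irrefl : ∀ x → adj x x ≡ false

verts : (n : ℕ) → List (Fin n)
verts n = Data.List.allFin n

-- rational a/d, with the convention a/0 = 0 (only used where d > 0 matters)
_over_ : ℕ → ℕ → ℚ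
a over zero = 0ℚ
a over suc d = (+ a) / suc d

sumℚ : List ℚ → ℚ
sumℚ = foldr _+_ 0ℚ

prodℚ : List ℚ → ℚ
prodℚ = foldr _*_ 1ℚ

consF : {A : Set} {k : ℕ} → A → (Fin k → A) → Fin (suc k) → A
consF a f Fin.zero = a
consF a f (Fin.suc i) = f i

funs : {A : Set} (k : ℕ) → List A → List (Fin k → A)
funs zero xs = (λ ()) ∷ []
funs (suc k) xs = concatMap (λ a → map (λ f → consF a f) (funs k xs)) xs

bools : List Bool
bools = true ∷ false ∷ []

module _ (G : Graph) where
  open Graph G

  deg : Fin n → ℕ
  deg v = sumℕ (map (λ u → if adj v u then 1 else 0) (verts n))

  -- Outcome of all random choices, pre-sampled independently per vertex v:
  --   (i) whether v ∈ I, (ii) the neighbour chosen by v, (iii) the coin deciding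
  --   whether the arc (v, chosen neighbour) is added to M⃗.
  Outcome : Set
  Outcome = Fin n → Bool × Fin n × Bool

  outcomes : List Outcome
  outcomes = funs n (concatMap (λ i → concatMap (λ u → map (λ b → (i , u , b)) bools) (verts n)) bools)

  -- probability that v chooses u: uniform over neighbours; if v is isolated,
  -- a dummy choice u = v with probability 1 (never used).
  chooseW : Fin n → Fin n → ℚ
  chooseW v u with deg v
  ... | zero = if ⌊ u ≟ v ⌋ then 1ℚ else 0ℚ
  ... | suc d = if adj v u then 1 over suc d else 0ℚ

  keepP : Fin n → Fin n → ℚ
  keepP v u = (deg u ⊓ deg v) over deg u

  coinW : Fin n → Fin n → Bool → ℚ
  coinW v u true = keepP v u
  coinW v u false = 1ℚ - keepP v u

  vertexW : Fin n → Bool × Fin n × Bool → ℚ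
  vertexW v (i , u , b) = (1 over 2) * (chooseW v u * coinW v u b)

  weight : Outcome → ℚ
  weight ω = prodℚ (map (λ v → vertexW v (ω v)) (verts n))

  inI : Outcome → Fin n → Bool
  inI ω v with ω v
  ... | (i , _ , _) = i

  arc : Outcome → Fin n → Fin n → Bool
  arc ω v u with ω v
  ... | (i , c , b) = i ∧ adj v u ∧ ⌊ c ≟ u ⌋ ∧ b

  indeg : Outcome → Fin n → ℕ
  indeg ω u = sumℕ (map (λ v → if arc ω v u then 1 else 0) (verts n))

  inMdir : Outcome → Fin n → Fin n → Bool
  inMdir ω v u = arc ω v u ∧ not (inI ω u) ∧ ⌊ indeg ω u ℕ.≟ 1 ⌋

  inM : Outcome → Fin n → Fin n → Bool
  inM ω x y = inMdir ω x y Data.Bool.∨ inMdir ω y x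

  IsMatching : Outcome → Set
  IsMatching ω = ∀ x y z → inM ω x y ≡ true → inM ω x z ≡ true → y ≡ z

  Pr : (Outcome → Bool) → ℚ
  Pr E = sumℚ (map (λ ω → weight ω * (if E ω then 1ℚ else 0ℚ)) outcomes)

-- M is a matching: a vertex of I only sends arcs and a vertex outside I only receives
-- them, so a matched vertex is paired either with the neighbour it chose or with its
-- unique in-neighbour.
-- For an edge {u, v}, the event {u, v} ∈ M contains the disjoint events LoneArc u v and
-- LoneArc v u, where LoneArc x y says that x ∈ I sends its arc to y, y ∉ I, and no other
-- vertex sends an arc to y. This is a product event over the independent choices of the
-- vertices. The factor of x is ½ · (1/deg x) · min(deg x, deg y)/deg y = 1/(2 max(deg x, deg y)),
-- the factor of y is ½, and by the Weierstrass product inequality the other factors multiply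
-- to at least 1 - Σ_w Pr[w sends an arc to y] ≥ 1 - deg y · 1/(2 deg y) = ½. Hence each of the
-- two events has probability at least 1/(8 max(deg u, deg v)).
module Submission where

open import Defs
open import Data.Bool using (Bool; true; false; if_then_else_; _∧_; _∨_; not)
open import Data.Fin using (Fin; zero; suc; _≟_)
open import Data.List using (List; []; _∷_; _++_; map; concatMap; allFin)
open import Data.Bool.ListAction using (and; all)
open import Data.Nat.ListAction using () renaming (sum to sumℕ)
open import Data.Product using (_×_; _,_; proj₁; proj₂; ∃-syntax)
open import Data.Sum using (_⊎_; inj₁; inj₂)
open import Data.Empty using (⊥; ⊥-elim)
open import Function using (_∘_; case_of_)
open import Relation.Nullary using (¬_; Dec; yes; no)
open import Relation.Nullary.Decidable using (⌊_⌋; isYes≗does; dec-true; dec-false; ⌊⌋-map′)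
open import Relation.Binary.PropositionalEquality

∧-true⁻ : ∀ {a b} → a ∧ b ≡ true → a ≡ true × b ≡ true
∧-true⁻ {true} b≡true = refl , b≡true

∨-true⁻ : ∀ {a b} → a ∨ b ≡ true → a ≡ true ⊎ b ≡ true
∨-true⁻ {true}  _      = inj₁ refl
∨-true⁻ {false} b≡true = inj₂ b≡true

not-true⁻ : ∀ {a} → not a ≡ true → a ≡ false
not-true⁻ {false} _ = refl

⌊⌋-true : ∀ {A : Set} (a? : Dec A) → A → ⌊ a? ⌋ ≡ true
⌊⌋-true a? a = trans (isYes≗does a?) (dec-true a? a)

⌊⌋-false : ∀ {A : Set} (a? : Dec A) → ¬ A → ⌊ a? ⌋ ≡ false
⌊⌋-false a? ¬a = trans (isYes≗does a?) (dec-false a? ¬a)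

⌊⌋-true⁻ : ∀ {A : Set} (a? : Dec A) → ⌊ a? ⌋ ≡ true → A
⌊⌋-true⁻ (yes a) _ = a

module Fractions where
  open import Data.Nat as ℕ using (zero; suc; NonZero)
  import Data.Nat.Properties as ℕ
  open import Data.Nat.Solver using (module +-*-Solver)
  open +-*-Solver
  open import Data.Integer as ℤ using (+_)
  import Data.Integer.Properties as ℤ
  open import Data.Rational using (0ℚ; 1ℚ; ½; _+_; _*_; _≤_; toℚᵘ)
  open import Data.Rational.Properties
    using (toℚᵘ-fromℚᵘ; toℚᵘ-injective; toℚᵘ-cancel-≤; toℚᵘ-homo-*; toℚᵘ-homo-+;
           normalize-nonNeg; nonNegative⁻¹; ≤-refl; *-zeroˡ; +-identityʳ)
  import Data.Rational.Unnormalised as ℚᵘ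
  import Data.Rational.Unnormalised.Properties as ℚᵘ

  toℚᵘ-over : ∀ a d → toℚᵘ (a over suc d) ℚᵘ.≃ ℚᵘ.mkℚᵘ (+ a) d
  toℚᵘ-over a d = toℚᵘ-fromℚᵘ (ℚᵘ.mkℚᵘ (+ a) d)

  cross-≡⇒over-≡ : ∀ a b m n .{{_ : NonZero m}} .{{_ : NonZero n}} →
    a ℕ.* n ≡ b ℕ.* m → a over m ≡ b over n
  cross-≡⇒over-≡ a b (suc m) (suc n) eq = toℚᵘ-injective
    (ℚᵘ.≃-trans (toℚᵘ-over a m) (ℚᵘ.≃-trans (ℚᵘ.*≡* cross) (ℚᵘ.≃-sym (toℚᵘ-over b n))))
    where
    cross : + a ℤ.* + suc n ≡ + b ℤ.* + suc m
    cross = trans (sym (ℤ.pos-* a (suc n))) (trans (cong +_ eq) (ℤ.pos-* b (suc m)))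

  cross-≤⇒over-≤ : ∀ a b m n .{{_ : NonZero m}} .{{_ : NonZero n}} →
    a ℕ.* n ℕ.≤ b ℕ.* m → a over m ≤ b over n
  cross-≤⇒over-≤ a b (suc m) (suc n) le = toℚᵘ-cancel-≤
    (ℚᵘ.≤-respʳ-≃ (ℚᵘ.≃-sym (toℚᵘ-over b n)) (ℚᵘ.≤-respˡ-≃ (ℚᵘ.≃-sym (toℚᵘ-over a m)) (ℚᵘ.*≤* cross)))
    where
    cross : + a ℤ.* + suc n ℤ.≤ + b ℤ.* + suc m
    cross = subst₂ ℤ._≤_ (ℤ.pos-* a (suc n)) (ℤ.pos-* b (suc m)) (ℤ.+≤+ le)

  over-*-over : ∀ a b m n .{{_ : NonZero m}} .{{_ : NonZero n}} →
    (a over m) * (b over n) ≡ (a ℕ.* b) over (m ℕ.* n)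
  over-*-over a b (suc m) (suc n) = toℚᵘ-injective
    (ℚᵘ.≃-trans (toℚᵘ-homo-* (a over suc m) (b over suc n))
    (ℚᵘ.≃-trans (ℚᵘ.*-cong (toℚᵘ-over a m) (toℚᵘ-over b n))
    (ℚᵘ.≃-trans (ℚᵘ.*≡* (cong (ℤ._* + (suc m ℕ.* suc n)) (sym (ℤ.pos-* a b))))
    (ℚᵘ.≃-sym (toℚᵘ-over (a ℕ.* b) (n ℕ.+ m ℕ.* suc n))))))

  over-+-over : ∀ a b m n .{{_ : NonZero m}} .{{_ : NonZero n}} →
    (a over m) + (b over n) ≡ (a ℕ.* n ℕ.+ b ℕ.* m) over (m ℕ.* n)
  over-+-over a b (suc m) (suc n) = toℚᵘ-injective
    (ℚᵘ.≃-trans (toℚᵘ-homo-+ (a over suc m) (b over suc n))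
    (ℚᵘ.≃-trans (ℚᵘ.+-cong (toℚᵘ-over a m) (toℚᵘ-over b n))
    (ℚᵘ.≃-trans (ℚᵘ.*≡* (cong (ℤ._* + (suc m ℕ.* suc n)) numerator))
    (ℚᵘ.≃-sym (toℚᵘ-over (a ℕ.* suc n ℕ.+ b ℕ.* suc m) (n ℕ.+ m ℕ.* suc n))))))
    where
    numerator : + a ℤ.* + suc n ℤ.+ + b ℤ.* + suc m ≡ + (a ℕ.* suc n ℕ.+ b ℕ.* suc m)
    numerator = trans (cong₂ ℤ._+_ (sym (ℤ.pos-* a (suc n))) (sym (ℤ.pos-* b (suc m))))
                      (sym (ℤ.pos-+ (a ℕ.* suc n) (b ℕ.* suc m)))

  0≤over : ∀ a d → 0ℚ ≤ a over d
  0≤over a zero    = ≤-refl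
  0≤over a (suc d) = nonNegative⁻¹ _ {{normalize-nonNeg a (suc d)}}

  over≤1 : ∀ {a d} → a ℕ.≤ d → a over d ≤ 1ℚ
  over≤1 {d = zero}  _   = cross-≤⇒over-≤ 0 1 1 1 ℕ.z≤n
  over≤1 {a} {suc d} a≤d = cross-≤⇒over-≤ a 1 (suc d) 1
    (subst₂ ℕ._≤_ (sym (ℕ.*-identityʳ a)) (sym (ℕ.*-identityˡ (suc d))) a≤d)

  1/-antimono : ∀ {m n} .{{_ : NonZero m}} → m ℕ.≤ n → 1 over n ≤ 1 over m
  1/-antimono {suc m} {suc n} m≤n = cross-≤⇒over-≤ 1 1 (suc n) (suc m) (ℕ.*-monoʳ-≤ 1 m≤n)

  n*1/n≡1 : ∀ n .{{_ : NonZero n}} → (n over 1) * (1 over n) ≡ 1ℚ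
  n*1/n≡1 n@(suc _) = trans (over-*-over n 1 1 n) (cross-≡⇒over-≡ (n ℕ.* 1) 1 (1 ℕ.* n) 1
    (solve 1 (λ n → n :* con 1 :* con 1 := con 1 :* (con 1 :* n)) refl n))

  n*1/[2*n]≡½ : ∀ b → (suc b over 1) * (1 over (2 ℕ.* suc b)) ≡ ½
  n*1/[2*n]≡½ b = trans (over-*-over (suc b) 1 1 (2 ℕ.* suc b))
    (cross-≡⇒over-≡ (suc b ℕ.* 1) 1 (1 ℕ.* (2 ℕ.* suc b)) 2
      (solve 1 (λ n → n :* con 1 :* con 2 := con 1 :* (con 1 :* (con 2 :* n))) refl (suc b)))

  ⊓*⊔≡* : ∀ a b → (b ℕ.⊓ a) ℕ.* (a ℕ.⊔ b) ≡ a ℕ.* b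
  ⊓*⊔≡* a b with ℕ.≤-total a b
  ... | inj₁ a≤b = cong₂ ℕ._*_ (ℕ.m≥n⇒m⊓n≡n a≤b) (ℕ.m≤n⇒m⊔n≡n a≤b)
  ... | inj₂ b≤a = trans (cong₂ ℕ._*_ (ℕ.m≤n⇒m⊓n≡m b≤a) (ℕ.m≥n⇒m⊔n≡m b≤a)) (ℕ.*-comm b a)

  ½*1/m*[n⊓m]/n≡1/[2*[m⊔n]] : ∀ a b →
    ½ * ((1 over suc a) * ((suc b ℕ.⊓ suc a) over suc b)) ≡ 1 over (2 ℕ.* (suc a ℕ.⊔ suc b))
  ½*1/m*[n⊓m]/n≡1/[2*[m⊔n]] a b = begin
    ½ * ((1 over m) * (p over n))               ≡⟨ cong (½ *_) (over-*-over 1 p m n) ⟩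
    ½ * ((1 ℕ.* p) over (m ℕ.* n))              ≡⟨ over-*-over 1 (1 ℕ.* p) 2 (m ℕ.* n) ⟩
    (1 ℕ.* (1 ℕ.* p)) over (2 ℕ.* (m ℕ.* n))    ≡⟨ cross-≡⇒over-≡ (1 ℕ.* (1 ℕ.* p)) 1 (2 ℕ.* (m ℕ.* n)) _ cross ⟩
    1 over (2 ℕ.* (m ℕ.⊔ n))                    ∎
    where
    open ≡-Reasoning
    m = suc a
    n = suc b
    p = n ℕ.⊓ m
    cross : 1 ℕ.* (1 ℕ.* p) ℕ.* (2 ℕ.* (m ℕ.⊔ n)) ≡ 1 ℕ.* (2 ℕ.* (m ℕ.* n))
    cross = begin
      1 ℕ.* (1 ℕ.* p) ℕ.* (2 ℕ.* (m ℕ.⊔ n))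
        ≡⟨ solve 2 (λ p q → con 1 :* (con 1 :* p) :* (con 2 :* q) := con 1 :* (con 2 :* (p :* q)))
                   refl p (m ℕ.⊔ n) ⟩
      1 ℕ.* (2 ℕ.* (p ℕ.* (m ℕ.⊔ n)))       ≡⟨ cong (λ k → 1 ℕ.* (2 ℕ.* k)) (⊓*⊔≡* m n) ⟩
      1 ℕ.* (2 ℕ.* (m ℕ.* n))               ∎

  1/[8*m]≡1/[2*m]*[½*½] : ∀ m → 1 over (8 ℕ.* m) ≡ (1 over (2 ℕ.* m)) * (½ * ½)
  1/[8*m]≡1/[2*m]*[½*½] zero      = sym (*-zeroˡ (½ * ½))
  1/[8*m]≡1/[2*m]*[½*½] m@(suc _) = sym (trans (over-*-over 1 1 (2 ℕ.* m) 4)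
    (cross-≡⇒over-≡ 1 1 (2 ℕ.* m ℕ.* 4) (8 ℕ.* m)
      (solve 1 (λ m → con 1 :* (con 8 :* m) := con 1 :* (con 2 :* m :* con 4)) refl m)))

  1/[4*m]≡1/[8*m]+1/[8*m] : ∀ m → 1 over (4 ℕ.* m) ≡ 1 over (8 ℕ.* m) + 1 over (8 ℕ.* m)
  1/[4*m]≡1/[8*m]+1/[8*m] zero      = sym (+-identityʳ 0ℚ)
  1/[4*m]≡1/[8*m]+1/[8*m] m@(suc _) = sym (trans (over-+-over 1 1 (8 ℕ.* m) (8 ℕ.* m))
    (cross-≡⇒over-≡ (1 ℕ.* (8 ℕ.* m) ℕ.+ 1 ℕ.* (8 ℕ.* m)) 1 (8 ℕ.* m ℕ.* (8 ℕ.* m)) (4 ℕ.* m)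
      (solve 1 (λ m → (con 1 :* (con 8 :* m) :+ con 1 :* (con 8 :* m)) :* (con 4 :* m)
                      := con 1 :* (con 8 :* m :* (con 8 :* m))) refl m)))

module BigOperators where
  open import Data.Nat as ℕ using (ℕ; zero; suc)
  import Data.Nat.Properties as ℕ
  open import Data.Rational using (ℚ; 0ℚ; 1ℚ; _+_; _*_; _-_; -_; _≤_; nonNegative)
  open import Data.Rational.Properties hiding (_≟_)
  open import Data.Rational.Solver using (module +-*-Solver)
  open +-*-Solver
  open import Data.Vec.Functional using (updateAt)
  open import Data.List.Properties using (map-tabulate; map-++; map-∘; map-cong)
  open import Data.Fin.Properties using (suc-injective)
  open Fractions

  ind : Bool → ℚ
  ind b = if b then 1ℚ else 0ℚ

  count : ∀ {A : Set} → (A → Bool) → List A → ℕ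
  count p xs = sumℕ (map (λ x → if p x then 1 else 0) xs)

  ∏ : ∀ {k} → (Fin k → ℚ) → ℚ
  ∏ {k} h = prodℚ (map h (allFin k))

  0≤if : ∀ b {q} → 0ℚ ≤ q → 0ℚ ≤ (if b then q else 0ℚ)
  0≤if true  0≤q = 0≤q
  0≤if false _   = ≤-refl

  0≤ind : ∀ b → 0ℚ ≤ ind b
  0≤ind b = 0≤if b (nonNegative⁻¹ 1ℚ)

  ind≤1 : ∀ b → ind b ≤ 1ℚ
  ind≤1 true  = ≤-refl
  ind≤1 false = nonNegative⁻¹ 1ℚ

  0≤*0≤⇒0≤ : ∀ {p q} → 0ℚ ≤ p → 0ℚ ≤ q → 0ℚ ≤ p * q
  0≤*0≤⇒0≤ {p} {q} 0≤p 0≤q =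
    nonNegative⁻¹ _ {{nonNeg*nonNeg⇒nonNeg p {{nonNegative 0≤p}} q {{nonNegative 0≤q}}}}

  p≤1⇒0≤1-p : ∀ {p} → p ≤ 1ℚ → 0ℚ ≤ 1ℚ - p
  p≤1⇒0≤1-p {p} p≤1 = ≤-trans (≤-reflexive (sym (+-inverseʳ p))) (+-monoˡ-≤ (- p) p≤1)

  0≤p⇒1-p≤1 : ∀ {p} → 0ℚ ≤ p → 1ℚ - p ≤ 1ℚ
  0≤p⇒1-p≤1 0≤p = ≤-trans (+-monoʳ-≤ 1ℚ (neg-antimono-≤ 0≤p)) (≤-reflexive (+-identityʳ 1ℚ))

  sum-++ : (xs ys : List ℚ) → sumℚ (xs ++ ys) ≡ sumℚ xs + sumℚ ys
  sum-++ []       ys = sym (+-identityˡ _)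
  sum-++ (x ∷ xs) ys = trans (cong (x +_) (sum-++ xs ys)) (sym (+-assoc x _ _))

  module _ {A : Set} where

    sum-concatMap : ∀ {B : Set} (f : B → ℚ) (g : A → List B) (xs : List A) →
      sumℚ (map f (concatMap g xs)) ≡ sumℚ (map (λ x → sumℚ (map f (g x))) xs)
    sum-concatMap f g []       = refl
    sum-concatMap f g (x ∷ xs) = begin
      sumℚ (map f (g x ++ concatMap g xs))            ≡⟨ cong sumℚ (map-++ f (g x) (concatMap g xs)) ⟩
      sumℚ (map f (g x) ++ map f (concatMap g xs))    ≡⟨ sum-++ (map f (g x)) _ ⟩
      sumℚ (map f (g x)) + sumℚ (map f (concatMap g xs)) ≡⟨ cong (sumℚ (map f (g x)) +_) (sum-concatMap f g xs) ⟩
      sumℚ (map f (g x)) + sumℚ (map (λ y → sumℚ (map f (g y))) xs) ∎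
      where open ≡-Reasoning

    sum-cong : ∀ {f g : A → ℚ} → (∀ x → f x ≡ g x) → ∀ xs → sumℚ (map f xs) ≡ sumℚ (map g xs)
    sum-cong f≗g []       = refl
    sum-cong f≗g (x ∷ xs) = cong₂ _+_ (f≗g x) (sum-cong f≗g xs)

    sum-0 : ∀ xs → sumℚ (map (λ (_ : A) → 0ℚ) xs) ≡ 0ℚ
    sum-0 []       = refl
    sum-0 (x ∷ xs) = trans (+-identityˡ _) (sum-0 xs)

    sum-mono : ∀ {f g : A → ℚ} → (∀ x → f x ≤ g x) → ∀ xs → sumℚ (map f xs) ≤ sumℚ (map g xs)
    sum-mono f≤g []       = ≤-refl
    sum-mono f≤g (x ∷ xs) = +-mono-≤ (f≤g x) (sum-mono f≤g xs)

    0≤sum : ∀ {f : A → ℚ} → (∀ x → 0ℚ ≤ f x) → ∀ xs → 0ℚ ≤ sumℚ (map f xs)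
    0≤sum 0≤f []       = ≤-refl
    0≤sum 0≤f (x ∷ xs) = ≤-trans (≤-reflexive (sym (+-identityˡ 0ℚ))) (+-mono-≤ (0≤f x) (0≤sum 0≤f xs))

    sum-*ˡ : ∀ c (f : A → ℚ) xs → sumℚ (map (λ x → c * f x) xs) ≡ c * sumℚ (map f xs)
    sum-*ˡ c f []       = sym (*-zeroʳ c)
    sum-*ˡ c f (x ∷ xs) = trans (cong (c * f x +_) (sum-*ˡ c f xs)) (sym (*-distribˡ-+ c (f x) _))

    sum-*ʳ : ∀ c (f : A → ℚ) xs → sumℚ (map (λ x → f x * c) xs) ≡ sumℚ (map f xs) * c
    sum-*ʳ c f []       = sym (*-zeroˡ c)
    sum-*ʳ c f (x ∷ xs) = trans (cong (f x * c +_) (sum-*ʳ c f xs)) (sym (*-distribʳ-+ c (f x) _))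

    sum-+ : ∀ (f g : A → ℚ) xs → sumℚ (map (λ x → f x + g x) xs) ≡ sumℚ (map f xs) + sumℚ (map g xs)
    sum-+ f g []       = refl
    sum-+ f g (x ∷ xs) = trans (cong (f x + g x +_) (sum-+ f g xs))
      (solve 4 (λ a b c d → (a :+ b) :+ (c :+ d) := (a :+ c) :+ (b :+ d)) refl (f x) (g x) _ _)

    sum-sub : ∀ (f g : A → ℚ) xs → sumℚ (map (λ x → f x - g x) xs) ≡ sumℚ (map f xs) - sumℚ (map g xs)
    sum-sub f g []       = refl
    sum-sub f g (x ∷ xs) = trans (cong (f x - g x +_) (sum-sub f g xs))
      (solve 4 (λ a b c d → (a :- b) :+ (c :- d) := (a :+ c) :- (b :+ d)) refl (f x) (g x) _ _)

    sum-if : ∀ (p : A → Bool) q xs → sumℚ (map (λ x → if p x then q else 0ℚ) xs) ≡ (count p xs over 1) * q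
    sum-if p q []       = sym (*-zeroˡ q)
    sum-if p q (x ∷ xs) with p x
    ... | false = trans (+-identityˡ _) (sum-if p q xs)
    ... | true  = begin
      q + sumℚ (map (λ y → if p y then q else 0ℚ) xs) ≡⟨ cong (q +_) (sum-if p q xs) ⟩
      q + (c over 1) * q                              ≡⟨ solve 2 (λ q r → q :+ r :* q := (con 1ℚ :+ r) :* q) refl q (c over 1) ⟩
      (1ℚ + c over 1) * q                             ≡⟨ cong (_* q) (over-+-over 1 c 1 1) ⟩
      ((1 ℕ.* 1 ℕ.+ c ℕ.* 1) over 1) * q              ≡⟨ cong (λ k → (k over 1) * q) (cong suc (ℕ.*-identityʳ c)) ⟩
      (suc c over 1) * q                              ∎
      where
      open ≡-Reasoning
      c = count p xs

    0≤prod : ∀ {f : A → ℚ} → (∀ x → 0ℚ ≤ f x) → ∀ xs → 0ℚ ≤ prodℚ (map f xs)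
    0≤prod 0≤f []       = nonNegative⁻¹ 1ℚ
    0≤prod 0≤f (x ∷ xs) = 0≤*0≤⇒0≤ (0≤f x) (0≤prod 0≤f xs)

    prod-*-ind : ∀ (f : A → ℚ) (p : A → Bool) xs →
      prodℚ (map (λ x → f x * ind (p x)) xs) ≡ prodℚ (map f xs) * ind (all p xs)
    prod-*-ind f p []       = refl
    prod-*-ind f p (x ∷ xs) with p x
    ... | true  = trans (cong₂ _*_ (*-identityʳ (f x)) (prod-*-ind f p xs)) (sym (*-assoc (f x) _ _))
    ... | false = solve 3 (λ a b c → (a :* con 0ℚ) :* b := (a :* c) :* con 0ℚ) refl (f x) _ _

    weierstrass : ∀ (f : A → ℚ) → (∀ x → 0ℚ ≤ f x) → (∀ x → f x ≤ 1ℚ) →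
      ∀ xs → 1ℚ - sumℚ (map (λ x → 1ℚ - f x) xs) ≤ prodℚ (map f xs)
    weierstrass f 0≤f f≤1 []       = ≤-refl
    weierstrass f 0≤f f≤1 (x ∷ xs) = begin
      1ℚ - ((1ℚ - a) + s)
        ≡⟨ solve 2 (λ a s → con 1ℚ :- ((con 1ℚ :- a) :+ s) := a :* (con 1ℚ :- s) :- (con 1ℚ :- a) :* s)
                   refl a s ⟩
      a * (1ℚ - s) - (1ℚ - a) * s ≤⟨ +-mono-≤ (*-monoˡ-≤-nonNeg a {{nonNegative (0≤f x)}} (weierstrass f 0≤f f≤1 xs))
                                              (neg-antimono-≤ (0≤*0≤⇒0≤ (p≤1⇒0≤1-p (f≤1 x)) 0≤s)) ⟩
      a * prodℚ (map f xs) - 0ℚ   ≡⟨ +-identityʳ _ ⟩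
      a * prodℚ (map f xs)        ∎
      where
      open ≤-Reasoning
      a = f x
      s = sumℚ (map (λ y → 1ℚ - f y) xs)
      0≤s : 0ℚ ≤ s
      0≤s = 0≤sum (λ y → p≤1⇒0≤1-p (f≤1 y)) xs

  map-allFin-suc : ∀ {A : Set} {k} (f : Fin (suc k) → A) →
    map f (allFin (suc k)) ≡ f zero ∷ map (f ∘ suc) (allFin k)
  map-allFin-suc f = cong (f zero ∷_) (trans (map-tabulate suc f) (sym (map-tabulate (λ i → i) (f ∘ suc))))

  ≟-suc : ∀ {k} (c y : Fin k) → ⌊ suc c ≟ suc y ⌋ ≡ ⌊ c ≟ y ⌋
  ≟-suc c y = ⌊⌋-map′ (cong suc) suc-injective (c ≟ y)

  sum-δ : ∀ {k} (y : Fin k) (f : Fin k → ℚ) →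
    sumℚ (map (λ c → if ⌊ c ≟ y ⌋ then f c else 0ℚ) (allFin k)) ≡ f y
  sum-δ {suc k} zero f = begin
    sumℚ (map (λ c → if ⌊ c ≟ zero ⌋ then f c else 0ℚ) (allFin (suc k)))
      ≡⟨ cong sumℚ (map-allFin-suc (λ c → if ⌊ c ≟ zero ⌋ then f c else 0ℚ)) ⟩
    f zero + sumℚ (map (λ _ → 0ℚ) (allFin k)) ≡⟨ cong (f zero +_) (sum-0 (allFin k)) ⟩
    f zero + 0ℚ ≡⟨ +-identityʳ (f zero) ⟩
    f zero ∎
    where open ≡-Reasoning
  sum-δ {suc k} (suc y) f = begin
    sumℚ (map (λ c → if ⌊ c ≟ suc y ⌋ then f c else 0ℚ) (allFin (suc k)))
      ≡⟨ cong sumℚ (map-allFin-suc (λ c → if ⌊ c ≟ suc y ⌋ then f c else 0ℚ)) ⟩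
    0ℚ + sumℚ (map (λ c → if ⌊ suc c ≟ suc y ⌋ then f (suc c) else 0ℚ) (allFin k)) ≡⟨ +-identityˡ _ ⟩
    sumℚ (map (λ c → if ⌊ suc c ≟ suc y ⌋ then f (suc c) else 0ℚ) (allFin k))
      ≡⟨ sum-cong (λ c → cong (if_then f (suc c) else 0ℚ) (≟-suc c y)) (allFin k) ⟩
    sumℚ (map (λ c → if ⌊ c ≟ y ⌋ then f (suc c) else 0ℚ) (allFin k)) ≡⟨ sum-δ y (f ∘ suc) ⟩
    f (suc y) ∎
    where open ≡-Reasoning

  count-suc : ∀ {k} (p : Fin (suc k) → Bool) →
    count p (allFin (suc k)) ≡ (if p zero then 1 else 0) ℕ.+ count (p ∘ suc) (allFin k)
  count-suc p = cong sumℕ (map-allFin-suc (λ v → if p v then 1 else 0))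

  count-δ : ∀ {k} (x : Fin k) (p : Fin k → Bool) → (∀ v → p v ≡ ⌊ v ≟ x ⌋) → count p (allFin k) ≡ 1
  count-δ {suc k} zero p p≗δ rewrite count-suc p | p≗δ zero =
    cong suc (trans (cong sumℕ (map-cong (λ v → cong (if_then 1 else 0) (p≗δ (suc v))) (allFin k)))
                    (count-false (allFin k)))
    where
    count-false : ∀ (vs : List (Fin k)) → sumℕ (map (λ v → if ⌊ suc v ≟ zero ⌋ then 1 else 0) vs) ≡ 0
    count-false []       = refl
    count-false (v ∷ vs) = count-false vs
  count-δ {suc k} (suc x) p p≗δ rewrite count-suc p | p≗δ zero =
    count-δ x (p ∘ suc) (λ v → trans (p≗δ (suc v)) (≟-suc v x))

  count-pos : ∀ {k} (p : Fin k → Bool) {v} → p v ≡ true → 1 ℕ.≤ count p (allFin k)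
  count-pos {suc k} p {zero} pv rewrite count-suc p | pv = ℕ.s≤s ℕ.z≤n
  count-pos {suc k} p {suc v} pv rewrite count-suc p =
    ℕ.≤-trans (count-pos (p ∘ suc) pv) (ℕ.m≤n+m _ (if p zero then 1 else 0))

  no-other : ∀ {k} (p : Fin (suc k) → Bool) → count p (allFin (suc k)) ≡ 1 →
    p zero ≡ true → ∀ {w} → p (suc w) ≡ true → ⊥
  no-other p c≡1 p0 pw rewrite count-suc p | p0 =
    case subst (1 ℕ.≤_) (ℕ.suc-injective c≡1) (count-pos (p ∘ suc) pw) of λ ()

  count≡1⇒unique : ∀ {k} (p : Fin k → Bool) → count p (allFin k) ≡ 1 →
    ∀ {v w} → p v ≡ true → p w ≡ true → v ≡ w
  count≡1⇒unique {suc k} p c≡1 {zero}  {zero}  pv pw = refl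
  count≡1⇒unique {suc k} p c≡1 {zero}  {suc w} pv pw = ⊥-elim (no-other p c≡1 pv pw)
  count≡1⇒unique {suc k} p c≡1 {suc v} {zero}  pv pw = ⊥-elim (no-other p c≡1 pw pv)
  count≡1⇒unique {suc k} p c≡1 {suc v} {suc w} pv pw =
    cong suc (count≡1⇒unique (p ∘ suc) (rest≡1 (p zero) refl) pv pw)
    where
    rest≡1 : ∀ b → p zero ≡ b → count (p ∘ suc) (allFin k) ≡ 1
    rest≡1 true  p0 = ⊥-elim (no-other p c≡1 p0 pv)
    rest≡1 false p0 = trans (cong (λ b → (if b then 1 else 0) ℕ.+ count (p ∘ suc) (allFin k)) (sym p0))
                   (trans (sym (count-suc p)) c≡1)

  all-allFin⁻ : ∀ {k} (p : Fin k → Bool) → all p (allFin k) ≡ true → ∀ w → p w ≡ true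
  all-allFin⁻ {suc k} p all≡true w with ∧-true⁻ {p zero} (trans (cong and (sym (map-allFin-suc p))) all≡true)
  ... | p0 , rest with w
  ...   | zero  = p0
  ...   | suc w = all-allFin⁻ (p ∘ suc) rest w

  ∏-suc : ∀ {k} (h : Fin (suc k) → ℚ) → ∏ h ≡ h zero * ∏ (h ∘ suc)
  ∏-suc h = cong prodℚ (map-allFin-suc h)

  ∏-updateAt : ∀ {k} (x : Fin k) (h : Fin k → ℚ) → ∏ h ≡ h x * ∏ (updateAt h x (λ _ → 1ℚ))
  ∏-updateAt {suc k} zero h = begin
    ∏ h                                          ≡⟨ ∏-suc h ⟩
    h zero * ∏ (h ∘ suc)                         ≡⟨ cong (h zero *_) (sym (*-identityˡ _)) ⟩
    h zero * (1ℚ * ∏ (h ∘ suc))                  ≡⟨ cong (h zero *_) (sym (∏-suc (updateAt h zero (λ _ → 1ℚ)))) ⟩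
    h zero * ∏ (updateAt h zero (λ _ → 1ℚ))      ∎
    where open ≡-Reasoning
  ∏-updateAt {suc k} (suc x) h = begin
    ∏ h                                                       ≡⟨ ∏-suc h ⟩
    h zero * ∏ (h ∘ suc)                                      ≡⟨ cong (h zero *_) (∏-updateAt x (h ∘ suc)) ⟩
    h zero * (h (suc x) * ∏ (updateAt (h ∘ suc) x (λ _ → 1ℚ)))
      ≡⟨ solve 3 (λ a b c → a :* (b :* c) := b :* (a :* c)) refl (h zero) (h (suc x)) _ ⟩
    h (suc x) * (h zero * ∏ (updateAt (h ∘ suc) x (λ _ → 1ℚ)))
      ≡⟨ cong (h (suc x) *_) (sym (∏-suc (updateAt h (suc x) (λ _ → 1ℚ)))) ⟩
    h (suc x) * ∏ (updateAt h (suc x) (λ _ → 1ℚ))              ∎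
    where open ≡-Reasoning

  sum-funs-∏ : ∀ {A : Set} k (g : Fin k → A → ℚ) (xs : List A) →
    sumℚ (map (λ ω → ∏ (λ v → g v (ω v))) (funs k xs)) ≡ ∏ (λ v → sumℚ (map (g v) xs))
  sum-funs-∏ zero    g xs = +-identityʳ 1ℚ
  sum-funs-∏ (suc k) g xs = begin
    sumℚ (map F (concatMap (λ a → map (consF a) (funs k xs)) xs))  ≡⟨ sum-concatMap F _ xs ⟩
    sumℚ (map (λ a → sumℚ (map F (map (consF a) (funs k xs)))) xs)
      ≡⟨ sum-cong (λ a → trans (cong sumℚ (sym (map-∘ (funs k xs))))
                               (cong sumℚ (map-cong (λ ω → ∏-suc (λ v → g v (consF a ω v))) (funs k xs)))) xs ⟩
    sumℚ (map (λ a → sumℚ (map (λ ω → g zero a * F′ ω) (funs k xs))) xs)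
      ≡⟨ sum-cong (λ a → sum-*ˡ (g zero a) F′ (funs k xs)) xs ⟩
    sumℚ (map (λ a → g zero a * sumℚ (map F′ (funs k xs))) xs)      ≡⟨ sum-*ʳ _ (g zero) xs ⟩
    sumℚ (map (g zero) xs) * sumℚ (map F′ (funs k xs))             ≡⟨ cong (sumℚ (map (g zero) xs) *_) (sum-funs-∏ k (g ∘ suc) xs) ⟩
    sumℚ (map (g zero) xs) * ∏ (λ v → sumℚ (map (g (suc v)) xs))   ≡⟨ sym (∏-suc (λ v → sumℚ (map (g v) xs))) ⟩
    ∏ (λ v → sumℚ (map (g v) xs))                                  ∎
    where
    open ≡-Reasoning
    F = λ ω → ∏ (λ v → g v (ω v))
    F′ = λ (ω : Fin k → _) → ∏ (λ v → g (suc v) (ω v))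

module Procedure (G : Graph) where
  open Graph G renaming (sym to adj-sym)
  open import Data.Nat as ℕ using (zero; suc; _⊔_; _⊓_)
  import Data.Nat.Properties as ℕ
  open import Data.Rational using (ℚ; 0ℚ; 1ℚ; ½; _+_; _*_; _-_; _≤_; nonNegative)
  open import Data.Rational.Properties hiding (_≟_)
  open import Data.Rational.Solver using (module +-*-Solver)
  open +-*-Solver
  open import Data.Vec.Functional using (updateAt)
  open import Data.Vec.Functional.Properties using (updateAt-updates; updateAt-minimal)
  open import Data.Bool.Properties using (∨-zeroʳ)
  open Fractions
  open BigOperators

  Choice : Set
  Choice = Bool × Fin n × Bool

  choices : List Choice
  choices = concatMap (λ i → concatMap (λ u → map (λ b → (i , u , b)) bools) (verts n)) bools

  Prᵥ : Fin n → (Choice → Bool) → ℚ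
  Prᵥ w p = sumℚ (map (λ c → vertexW G w c * ind (p c)) choices)

  arcTo : Fin n → Fin n → Choice → Bool
  arcTo w y (i , c , b) = i ∧ adj w y ∧ ⌊ c ≟ y ⌋ ∧ b

  notInI : Choice → Bool
  notInI (i , _ , _) = not i

  arc≡arcTo : ∀ ω w y → arc G ω w y ≡ arcTo w y (ω w)
  arc≡arcTo ω w y with ω w
  ... | _ = refl

  not-inI≡notInI : ∀ ω v → not (inI G ω v) ≡ notInI (ω v)
  not-inI≡notInI ω v with ω v
  ... | _ = refl

  adj⇒≢ : ∀ {x y} → adj x y ≡ true → y ≢ x
  adj⇒≢ {x} xy refl = case trans (sym xy) (irrefl x) of λ ()

  adj⇒deg-suc : ∀ {w y} → adj w y ≡ true → ∃[ d ] deg G w ≡ suc d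
  adj⇒deg-suc {w} wy with deg G w | count-pos (adj w) wy
  ... | suc d | _ = d , refl

  chooseW-suc : ∀ {w d} c → deg G w ≡ suc d → chooseW G w c ≡ (if adj w c then 1 over suc d else 0ℚ)
  chooseW-suc {w} c eq rewrite eq = refl

  chooseW-zero : ∀ {w} c → deg G w ≡ 0 → chooseW G w c ≡ (if ⌊ c ≟ w ⌋ then 1ℚ else 0ℚ)
  chooseW-zero {w} c eq rewrite eq = refl

  sum-chooseW : ∀ w → sumℚ (map (chooseW G w) (verts n)) ≡ 1ℚ
  sum-chooseW w = by-degree (deg G w) refl
    where
    open ≡-Reasoning
    by-degree : ∀ m → deg G w ≡ m → sumℚ (map (chooseW G w) (verts n)) ≡ 1ℚ
    by-degree zero    eq = trans (sum-cong (λ c → chooseW-zero c eq) (verts n)) (sum-δ w (λ _ → 1ℚ))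
    by-degree (suc d) eq = begin
      sumℚ (map (chooseW G w) (verts n))                                ≡⟨ sum-cong (λ c → chooseW-suc c eq) (verts n) ⟩
      sumℚ (map (λ c → if adj w c then 1 over suc d else 0ℚ) (verts n)) ≡⟨ sum-if (adj w) (1 over suc d) (verts n) ⟩
      (deg G w over 1) * (1 over suc d)                                 ≡⟨ cong (λ k → (k over 1) * (1 over suc d)) eq ⟩
      (suc d over 1) * (1 over suc d)                                   ≡⟨ n*1/n≡1 (suc d) ⟩
      1ℚ                                                                ∎

  0≤chooseW : ∀ w c → 0ℚ ≤ chooseW G w c
  0≤chooseW w c = by-degree (deg G w) refl
    where
    by-degree : ∀ m → deg G w ≡ m → 0ℚ ≤ chooseW G w c
    by-degree zero    eq = subst (0ℚ ≤_) (sym (chooseW-zero c eq)) (0≤ind ⌊ c ≟ w ⌋)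
    by-degree (suc d) eq = subst (0ℚ ≤_) (sym (chooseW-suc c eq)) (0≤if (adj w c) (0≤over 1 (suc d)))

  0≤coinW : ∀ w u b → 0ℚ ≤ coinW G w u b
  0≤coinW w u true  = 0≤over _ (deg G u)
  0≤coinW w u false = p≤1⇒0≤1-p (over≤1 (ℕ.m⊓n≤m (deg G u) (deg G w)))

  0≤vertexW : ∀ w c → 0ℚ ≤ vertexW G w c
  0≤vertexW w (i , u , b) = 0≤*0≤⇒0≤ (0≤over 1 2) (0≤*0≤⇒0≤ (0≤chooseW w u) (0≤coinW w u b))

  slice : Fin n → Bool → (Choice → Bool) → ℚ
  slice w i p =
    sumℚ (map (λ u → sumℚ (map (λ b → vertexW G w (i , u , b) * ind (p (i , u , b))) bools)) (verts n))

  Prᵥ-slices : ∀ w p → Prᵥ w p ≡ slice w true p + slice w false p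
  Prᵥ-slices w p = begin
    Prᵥ w p                                          ≡⟨ sum-concatMap f row bools ⟩
    sumℚ (map (λ i → sumℚ (map f (row i))) bools)
      ≡⟨ sum-cong (λ i → sum-concatMap f (λ u → map (λ b → (i , u , b)) bools) (verts n)) bools ⟩
    slice w true p + (slice w false p + 0ℚ)          ≡⟨ cong (slice w true p +_) (+-identityʳ _) ⟩
    slice w true p + slice w false p                 ∎
    where
    open ≡-Reasoning
    f = λ c → vertexW G w c * ind (p c)
    row = λ i → concatMap (λ u → map (λ b → (i , u , b)) bools) (verts n)

  slice-null : ∀ w i p → (∀ u b → p (i , u , b) ≡ false) → slice w i p ≡ 0ℚ
  slice-null w i p null = trans (sum-cong vanish (verts n)) (sum-0 (verts n))
    where
    vanish : ∀ u → sumℚ (map (λ b → vertexW G w (i , u , b) * ind (p (i , u , b))) bools) ≡ 0ℚ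
    vanish u rewrite null u true | null u false =
      solve 2 (λ x y → x :* con 0ℚ :+ (y :* con 0ℚ :+ con 0ℚ) := con 0ℚ) refl
            (vertexW G w (i , u , true)) (vertexW G w (i , u , false))

  slice-full : ∀ w i p → (∀ u b → p (i , u , b) ≡ true) → slice w i p ≡ ½
  slice-full w i p full = begin
    slice w i p                                    ≡⟨ sum-cong coin-sums-to-1 (verts n) ⟩
    sumℚ (map (λ u → ½ * chooseW G w u) (verts n)) ≡⟨ sum-*ˡ ½ (chooseW G w) (verts n) ⟩
    ½ * sumℚ (map (chooseW G w) (verts n))         ≡⟨ cong (½ *_) (sum-chooseW w) ⟩
    ½ * 1ℚ                                         ≡⟨ *-identityʳ ½ ⟩
    ½                                              ∎
    where
    open ≡-Reasoning
    coin-sums-to-1 : ∀ u →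
      sumℚ (map (λ b → vertexW G w (i , u , b) * ind (p (i , u , b))) bools) ≡ ½ * chooseW G w u
    coin-sums-to-1 u rewrite full u true | full u false =
      solve 3 (λ c χ k → c :* (χ :* k) :* con 1ℚ :+ (c :* (χ :* (con 1ℚ :- k)) :* con 1ℚ :+ con 0ℚ) := c :* χ)
            refl ½ (chooseW G w u) (keepP G w u)

  Prᵥ-total : ∀ w → Prᵥ w (λ _ → true) ≡ 1ℚ
  Prᵥ-total w = trans (Prᵥ-slices w always) (cong₂ _+_ (slice-full w true always (λ _ _ → refl))
                                                       (slice-full w false always (λ _ _ → refl)))
    where
    always : Choice → Bool
    always _ = true

  Prᵥ-notInI : ∀ w → Prᵥ w notInI ≡ ½
  Prᵥ-notInI w = trans (Prᵥ-slices w notInI) (cong₂ _+_ (slice-null w true notInI (λ _ _ → refl))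
                                                        (slice-full w false notInI (λ _ _ → refl)))

  Prᵥ-not : ∀ w p → Prᵥ w (not ∘ p) ≡ 1ℚ - Prᵥ w p
  Prᵥ-not w p = begin
    Prᵥ w (not ∘ p)                       ≡⟨ sum-cong (λ c → complement (vertexW G w c) (p c)) choices ⟩
    sumℚ (map (λ c → vertexW G w c * ind true - vertexW G w c * ind (p c)) choices) ≡⟨ sum-sub _ _ choices ⟩
    Prᵥ w (λ _ → true) - Prᵥ w p          ≡⟨ cong (_- Prᵥ w p) (Prᵥ-total w) ⟩
    1ℚ - Prᵥ w p                          ∎
    where
    open ≡-Reasoning
    complement : ∀ q b → q * ind (not b) ≡ q * ind true - q * ind b
    complement q true  = solve 1 (λ q → q :* con 0ℚ := q :* con 1ℚ :- q :* con 1ℚ) refl q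
    complement q false = solve 1 (λ q → q :* con 1ℚ := q :* con 1ℚ :- q :* con 0ℚ) refl q

  0≤Prᵥ : ∀ w p → 0ℚ ≤ Prᵥ w p
  0≤Prᵥ w p = 0≤sum (λ c → 0≤*0≤⇒0≤ (0≤vertexW w c) (0≤ind (p c))) choices

  Prᵥ≤1 : ∀ w p → Prᵥ w p ≤ 1ℚ
  Prᵥ≤1 w p = ≤-trans (sum-mono (λ c → *-monoˡ-≤-nonNeg (vertexW G w c) {{nonNegative (0≤vertexW w c)}} (ind≤1 (p c)))
                                choices)
                      (≤-reflexive (Prᵥ-total w))

  Prᵥ-arcTo : ∀ w y → Prᵥ w (arcTo w y) ≡ ind (adj w y) * (½ * (chooseW G w y * keepP G w y))
  Prᵥ-arcTo w y = begin
    Prᵥ w (arcTo w y)                                      ≡⟨ Prᵥ-slices w (arcTo w y) ⟩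
    slice w true (arcTo w y) + slice w false (arcTo w y)   ≡⟨ cong₂ _+_ chose-y (slice-null w false (arcTo w y) (λ _ _ → refl)) ⟩
    vertexW G w (true , y , true) * ind (adj w y) + 0ℚ     ≡⟨ +-identityʳ _ ⟩
    vertexW G w (true , y , true) * ind (adj w y)          ≡⟨ *-comm _ (ind (adj w y)) ⟩
    ind (adj w y) * (½ * (chooseW G w y * keepP G w y))    ∎
    where
    open ≡-Reasoning
    heads-only : ∀ p q a e →
      p * ind (a ∧ e ∧ true) + (q * ind (a ∧ e ∧ false) + 0ℚ) ≡ (if e then p * ind a else 0ℚ)
    heads-only p q true  true  = solve 2 (λ p q → p :* con 1ℚ :+ (q :* con 0ℚ :+ con 0ℚ) := p :* con 1ℚ) refl p q
    heads-only p q true  false = solve 2 (λ p q → p :* con 0ℚ :+ (q :* con 0ℚ :+ con 0ℚ) := con 0ℚ) refl p q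
    heads-only p q false true  = solve 2 (λ p q → p :* con 0ℚ :+ (q :* con 0ℚ :+ con 0ℚ) := p :* con 0ℚ) refl p q
    heads-only p q false false = solve 2 (λ p q → p :* con 0ℚ :+ (q :* con 0ℚ :+ con 0ℚ) := con 0ℚ) refl p q
    chose-y : slice w true (arcTo w y) ≡ vertexW G w (true , y , true) * ind (adj w y)
    chose-y = trans (sum-cong (λ u → heads-only (vertexW G w (true , u , true)) (vertexW G w (true , u , false))
                                                (adj w y) ⌊ u ≟ y ⌋) (verts n))
                    (sum-δ y (λ u → vertexW G w (true , u , true) * ind (adj w y)))

  Prᵥ-arcTo-adj : ∀ {w y} → adj w y ≡ true → Prᵥ w (arcTo w y) ≡ 1 over (2 ℕ.* (deg G w ⊔ deg G y))
  Prᵥ-arcTo-adj {w} {y} wy with adj⇒deg-suc wy | adj⇒deg-suc (trans (adj-sym y w) wy)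
  ... | a , dw | b , dy = begin
    Prᵥ w (arcTo w y)                                          ≡⟨ Prᵥ-arcTo w y ⟩
    ind (adj w y) * (½ * (chooseW G w y * keepP G w y))
      ≡⟨ cong₂ (λ i χ → ind i * (½ * (χ * keepP G w y))) wy
               (trans (chooseW-suc y dw) (cong (if_then 1 over suc a else 0ℚ) wy)) ⟩
    1ℚ * (½ * ((1 over suc a) * keepP G w y))                  ≡⟨ *-identityˡ _ ⟩
    ½ * ((1 over suc a) * ((deg G y ⊓ deg G w) over deg G y))  ≡⟨ cong₂ (λ p q → ½ * ((1 over suc a) * ((q ⊓ p) over q))) dw dy ⟩
    ½ * ((1 over suc a) * ((suc b ⊓ suc a) over suc b))        ≡⟨ ½*1/m*[n⊓m]/n≡1/[2*[m⊔n]] a b ⟩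
    1 over (2 ℕ.* (suc a ⊔ suc b))                             ≡⟨ cong₂ (λ p q → 1 over (2 ℕ.* (p ⊔ q))) dw dy ⟨
    1 over (2 ℕ.* (deg G w ⊔ deg G y))                         ∎
    where open ≡-Reasoning

  Prᵥ-arcTo-non-adj : ∀ {w y} → adj w y ≡ false → Prᵥ w (arcTo w y) ≡ 0ℚ
  Prᵥ-arcTo-non-adj {w} {y} w≁y =
    trans (Prᵥ-arcTo w y) (trans (cong (λ i → ind i * chose-and-kept) w≁y) (*-zeroˡ chose-and-kept))
    where chose-and-kept = ½ * (chooseW G w y * keepP G w y)

  Prᵥ-arcTo≤ : ∀ w {y b} → deg G y ≡ suc b →
    Prᵥ w (arcTo w y) ≤ (if adj y w then 1 over (2 ℕ.* suc b) else 0ℚ)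
  Prᵥ-arcTo≤ w {y} {b} dy with adj y w in yw
  ... | true  = ≤-trans (≤-reflexive (Prᵥ-arcTo-adj (trans (adj-sym w y) yw))) (1/-antimono 2deg≤2max)
    where
    2deg≤2max : 2 ℕ.* suc b ℕ.≤ 2 ℕ.* (deg G w ⊔ deg G y)
    2deg≤2max = subst (λ d → 2 ℕ.* d ℕ.≤ 2 ℕ.* (deg G w ⊔ deg G y)) dy (ℕ.*-monoʳ-≤ 2 (ℕ.m≤n⊔m (deg G w) (deg G y)))
  ... | false = ≤-reflexive (Prᵥ-arcTo-non-adj (trans (adj-sym w y) yw))

  ∑-Prᵥ-arcTo≤½ : ∀ {y b} → deg G y ≡ suc b → sumℚ (map (λ w → Prᵥ w (arcTo w y)) (verts n)) ≤ ½
  ∑-Prᵥ-arcTo≤½ {y} {b} dy = begin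
    sumℚ (map (λ w → Prᵥ w (arcTo w y)) (verts n))                               ≤⟨ sum-mono (λ w → Prᵥ-arcTo≤ w dy) (verts n) ⟩
    sumℚ (map (λ w → if adj y w then 1 over (2 ℕ.* suc b) else 0ℚ) (verts n))   ≡⟨ sum-if (adj y) _ (verts n) ⟩
    (deg G y over 1) * (1 over (2 ℕ.* suc b))                                    ≡⟨ cong (λ k → (k over 1) * (1 over (2 ℕ.* suc b))) dy ⟩
    (suc b over 1) * (1 over (2 ℕ.* suc b))                                      ≡⟨ n*1/[2*n]≡½ b ⟩
    ½                                                                            ∎
    where open ≤-Reasoning

  arcTo-non-adj : ∀ {w y} c → adj w y ≡ false → arcTo w y c ≡ false
  arcTo-non-adj (false , _ , _) _   = refl
  arcTo-non-adj (true  , _ , _) w≁y rewrite w≁y = refl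

  arcTo⇒inI : ∀ {w y} c → arcTo w y c ≡ true → notInI c ≡ false
  arcTo⇒inI (true , _ , _) _ = refl

  arcTo⇒chose : ∀ {w y} c → arcTo w y c ≡ true → proj₁ (proj₂ c) ≡ y
  arcTo⇒chose {w} {y} (true , u , _) arc≡true =
    ⌊⌋-true⁻ (u ≟ y) (proj₁ (∧-true⁻ {⌊ u ≟ y ⌋} (proj₂ (∧-true⁻ {adj w y} arc≡true))))

  module _ (ω : Outcome G) (x y : Fin n) (x↦y : inMdir G ω x y ≡ true) where

    inMdir⇒arc : arc G ω x y ≡ true
    inMdir⇒arc = proj₁ (∧-true⁻ {arc G ω x y} x↦y)

    inMdir⇒arcTo : arcTo x y (ω x) ≡ true
    inMdir⇒arcTo = trans (sym (arc≡arcTo ω x y)) inMdir⇒arc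

    private
      y∉I∧indeg≡1 : not (inI G ω y) ∧ ⌊ indeg G ω y ℕ.≟ 1 ⌋ ≡ true
      y∉I∧indeg≡1 = proj₂ (∧-true⁻ {arc G ω x y} x↦y)

    inMdir⇒notInI : notInI (ω y) ≡ true
    inMdir⇒notInI = trans (sym (not-inI≡notInI ω y)) (proj₁ (∧-true⁻ y∉I∧indeg≡1))

    inMdir⇒indeg≡1 : indeg G ω y ≡ 1
    inMdir⇒indeg≡1 = ⌊⌋-true⁻ (indeg G ω y ℕ.≟ 1) (proj₂ (∧-true⁻ y∉I∧indeg≡1))

  isMatching : ∀ ω → IsMatching G ω
  isMatching ω x y z xy zx = by-direction (∨-true⁻ xy) (∨-true⁻ zx)
    where
    in-and-out : ∀ {v} → notInI (ω v) ≡ false → notInI (ω v) ≡ true → ⊥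
    in-and-out p q = case trans (sym p) q of λ ()
    by-direction : inMdir G ω x y ≡ true ⊎ inMdir G ω y x ≡ true →
                   inMdir G ω x z ≡ true ⊎ inMdir G ω z x ≡ true → y ≡ z
    by-direction (inj₁ x↦y) (inj₁ x↦z) =
      trans (sym (arcTo⇒chose (ω x) (inMdir⇒arcTo ω x y x↦y))) (arcTo⇒chose (ω x) (inMdir⇒arcTo ω x z x↦z))
    by-direction (inj₁ x↦y) (inj₂ z↦x) =
      ⊥-elim (in-and-out (arcTo⇒inI (ω x) (inMdir⇒arcTo ω x y x↦y)) (inMdir⇒notInI ω z x z↦x))
    by-direction (inj₂ y↦x) (inj₁ x↦z) =
      ⊥-elim (in-and-out (arcTo⇒inI (ω x) (inMdir⇒arcTo ω x z x↦z)) (inMdir⇒notInI ω y x y↦x))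
    by-direction (inj₂ y↦x) (inj₂ z↦x) =
      count≡1⇒unique (λ v → arc G ω v x) (inMdir⇒indeg≡1 ω y x y↦x) (inMdir⇒arc ω y x y↦x) (inMdir⇒arc ω z x z↦x)

  loneArcTest : Fin n → Fin n → Fin n → Choice → Bool
  loneArcTest x y w = if ⌊ w ≟ x ⌋ then arcTo x y else if ⌊ w ≟ y ⌋ then notInI else not ∘ arcTo w y

  LoneArc : Fin n → Fin n → Outcome G → Bool
  LoneArc x y ω = all (λ w → loneArcTest x y w (ω w)) (verts n)

  loneArcTest-x : ∀ x y c → loneArcTest x y x c ≡ arcTo x y c
  loneArcTest-x x y c rewrite ⌊⌋-true (x ≟ x) refl = refl

  loneArcTest-y : ∀ {x y} → y ≢ x → ∀ c → loneArcTest x y y c ≡ notInI c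
  loneArcTest-y {x} {y} y≢x c rewrite ⌊⌋-false (y ≟ x) y≢x | ⌊⌋-true (y ≟ y) refl = refl

  loneArcTest-other : ∀ {x y w} → w ≢ x → w ≢ y → ∀ c → loneArcTest x y w c ≡ not (arcTo w y c)
  loneArcTest-other {x} {y} {w} w≢x w≢y c rewrite ⌊⌋-false (w ≟ x) w≢x | ⌊⌋-false (w ≟ y) w≢y = refl

  LoneArc⇒inMdir : ∀ {x y} ω → adj x y ≡ true → LoneArc x y ω ≡ true → inMdir G ω x y ≡ true
  LoneArc⇒inMdir {x} {y} ω xy lone =
    trans (cong₂ (λ a b → a ∧ b ∧ ⌊ indeg G ω y ℕ.≟ 1 ⌋) x↦y y∉I) (⌊⌋-true (indeg G ω y ℕ.≟ 1) indeg≡1)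
    where
    test : ∀ w → loneArcTest x y w (ω w) ≡ true
    test = all-allFin⁻ (λ w → loneArcTest x y w (ω w)) lone
    x↦y : arc G ω x y ≡ true
    x↦y = trans (arc≡arcTo ω x y) (trans (sym (loneArcTest-x x y (ω x))) (test x))
    y∉I : not (inI G ω y) ≡ true
    y∉I = trans (not-inI≡notInI ω y) (trans (sym (loneArcTest-y (adj⇒≢ xy) (ω y))) (test y))
    only-x : ∀ v → arc G ω v y ≡ ⌊ v ≟ x ⌋
    only-x v with v ≟ x | v ≟ y
    ... | yes refl | _        = x↦y
    ... | no  _    | yes refl = trans (arc≡arcTo ω y y) (arcTo-non-adj (ω y) (irrefl y))
    ... | no  v≢x  | no  v≢y  =
      trans (arc≡arcTo ω v y) (not-true⁻ (trans (sym (loneArcTest-other v≢x v≢y (ω v))) (test v)))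
    indeg≡1 : indeg G ω y ≡ 1
    indeg≡1 = count-δ x (λ v → arc G ω v y) only-x

  LoneArc-disjoint : ∀ {u v} ω → adj u v ≡ true → LoneArc u v ω ≡ true → LoneArc v u ω ≡ true → ⊥
  LoneArc-disjoint {u} {v} ω uv uv-lone vu-lone = case trans (sym u∈I) u∉I of λ ()
    where
    u∈I : notInI (ω u) ≡ false
    u∈I = arcTo⇒inI (ω u) (trans (sym (loneArcTest-x u v (ω u)))
                                 (all-allFin⁻ (λ w → loneArcTest u v w (ω w)) uv-lone u))
    u∉I : notInI (ω u) ≡ true
    u∉I = trans (sym (loneArcTest-y (adj⇒≢ (trans (adj-sym v u) uv)) (ω u)))
                (all-allFin⁻ (λ w → loneArcTest v u w (ω w)) vu-lone u)

  Pr-all≡∏ : ∀ (P : Fin n → Choice → Bool) →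
    Pr G (λ ω → all (λ w → P w (ω w)) (verts n)) ≡ ∏ (λ w → Prᵥ w (P w))
  Pr-all≡∏ P = begin
    Pr G (λ ω → all (λ w → P w (ω w)) (verts n))
      ≡⟨ sum-cong (λ ω → sym (prod-*-ind (λ w → vertexW G w (ω w)) (λ w → P w (ω w)) (verts n))) (outcomes G) ⟩
    sumℚ (map (λ ω → ∏ (λ w → vertexW G w (ω w) * ind (P w (ω w)))) (funs n choices))
      ≡⟨ sum-funs-∏ n (λ w c → vertexW G w c * ind (P w c)) choices ⟩
    ∏ (λ w → Prᵥ w (P w)) ∎
    where open ≡-Reasoning

  Pr-+-≤ : ∀ E F H → (∀ ω → ind (E ω) + ind (F ω) ≤ ind (H ω)) → Pr G E + Pr G F ≤ Pr G H
  Pr-+-≤ E F H E+F≤H = begin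
    Pr G E + Pr G F                                                          ≡⟨ sum-+ _ _ (outcomes G) ⟨
    sumℚ (map (λ ω → weight G ω * ind (E ω) + weight G ω * ind (F ω)) (outcomes G)) ≤⟨ sum-mono pointwise (outcomes G) ⟩
    Pr G H                                                                   ∎
    where
    open ≤-Reasoning
    pointwise : ∀ ω → weight G ω * ind (E ω) + weight G ω * ind (F ω) ≤ weight G ω * ind (H ω)
    pointwise ω = ≤-trans (≤-reflexive (sym (*-distribˡ-+ (weight G ω) _ _)))
      (*-monoˡ-≤-nonNeg (weight G ω) {{nonNegative (0≤prod (λ v → 0≤vertexW v (ω v)) (verts n))}} (E+F≤H ω))

  Pr-LoneArc+Pr-LoneArc≤Pr-inM : ∀ {u v} → adj u v ≡ true →
    Pr G (LoneArc u v) + Pr G (LoneArc v u) ≤ Pr G (λ ω → inM G ω u v)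
  Pr-LoneArc+Pr-LoneArc≤Pr-inM {u} {v} uv = Pr-+-≤ (LoneArc u v) (LoneArc v u) (λ ω → inM G ω u v) pointwise
    where
    vu = trans (adj-sym v u) uv
    pointwise : ∀ ω → ind (LoneArc u v ω) + ind (LoneArc v u ω) ≤ ind (inM G ω u v)
    pointwise ω with LoneArc u v ω in uv-lone | LoneArc v u ω in vu-lone
    ... | true  | true  = ⊥-elim (LoneArc-disjoint ω uv uv-lone vu-lone)
    ... | true  | false = ≤-reflexive (cong (λ b → ind (b ∨ inMdir G ω v u)) (sym (LoneArc⇒inMdir ω uv uv-lone)))
    ... | false | true  = ≤-reflexive (cong ind (sym (trans (cong (inMdir G ω u v ∨_) (LoneArc⇒inMdir ω vu vu-lone))
                                                            (∨-zeroʳ (inMdir G ω u v)))))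
    ... | false | false = 0≤ind (inM G ω u v)

  Prᵥ-cong : ∀ w {p q} → (∀ c → p c ≡ q c) → Prᵥ w p ≡ Prᵥ w q
  Prᵥ-cong w p≗q = sum-cong (λ c → cong (λ b → vertexW G w c * ind b) (p≗q c)) choices

  lonePr : Fin n → Fin n → Fin n → ℚ
  lonePr x y w = Prᵥ w (loneArcTest x y w)

  othersPr : Fin n → Fin n → Fin n → ℚ
  othersPr x y = updateAt (updateAt (lonePr x y) x (λ _ → 1ℚ)) y (λ _ → 1ℚ)

  othersPr-cases : ∀ x y w → othersPr x y w ≡ 1ℚ ⊎ othersPr x y w ≡ 1ℚ - Prᵥ w (arcTo w y)
  othersPr-cases x y w with w ≟ y | w ≟ x
  ... | yes refl | _        = inj₁ (updateAt-updates w _)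
  ... | no  w≢y  | yes refl = inj₁ (trans (updateAt-minimal w y _ w≢y) (updateAt-updates w _))
  ... | no  w≢y  | no  w≢x  = inj₂ (begin
    othersPr x y w                 ≡⟨ updateAt-minimal w y _ w≢y ⟩
    updateAt (lonePr x y) x _ w    ≡⟨ updateAt-minimal w x _ w≢x ⟩
    Prᵥ w (loneArcTest x y w)      ≡⟨ Prᵥ-cong w (loneArcTest-other w≢x w≢y) ⟩
    Prᵥ w (not ∘ arcTo w y)        ≡⟨ Prᵥ-not w (arcTo w y) ⟩
    1ℚ - Prᵥ w (arcTo w y)         ∎)
    where open ≡-Reasoning

  ½≤∏-othersPr : ∀ x {y b} → deg G y ≡ suc b → ½ ≤ ∏ (othersPr x y)
  ½≤∏-othersPr x {y} dy = begin
    ½                                                          ≡⟨⟩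
    1ℚ - ½                                                     ≤⟨ +-monoʳ-≤ 1ℚ (neg-antimono-≤ (∑-Prᵥ-arcTo≤½ dy)) ⟩
    1ℚ - sumℚ (map (λ w → Prᵥ w (arcTo w y)) (verts n))        ≤⟨ +-monoʳ-≤ 1ℚ (neg-antimono-≤ (sum-mono missing≤arc (verts n))) ⟩
    1ℚ - sumℚ (map (λ w → 1ℚ - othersPr x y w) (verts n))      ≤⟨ weierstrass (othersPr x y) 0≤others others≤1 (verts n) ⟩
    ∏ (othersPr x y)                                           ∎
    where
    open ≤-Reasoning
    0≤others : ∀ w → 0ℚ ≤ othersPr x y w
    0≤others w with othersPr-cases x y w
    ... | inj₁ eq = subst (0ℚ ≤_) (sym eq) (nonNegative⁻¹ 1ℚ)
    ... | inj₂ eq = subst (0ℚ ≤_) (sym eq) (p≤1⇒0≤1-p (Prᵥ≤1 w (arcTo w y)))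
    others≤1 : ∀ w → othersPr x y w ≤ 1ℚ
    others≤1 w with othersPr-cases x y w
    ... | inj₁ eq = ≤-reflexive eq
    ... | inj₂ eq = subst (_≤ 1ℚ) (sym eq) (0≤p⇒1-p≤1 (0≤Prᵥ w (arcTo w y)))
    missing≤arc : ∀ w → 1ℚ - othersPr x y w ≤ Prᵥ w (arcTo w y)
    missing≤arc w with othersPr-cases x y w
    ... | inj₁ eq = subst (λ q → 1ℚ - q ≤ Prᵥ w (arcTo w y)) (sym eq) (0≤Prᵥ w (arcTo w y))
    ... | inj₂ eq = ≤-reflexive (trans (cong (λ q → 1ℚ - q) eq)
                                       (solve 1 (λ p → con 1ℚ :- (con 1ℚ :- p) := p) refl (Prᵥ w (arcTo w y))))

  Pr-LoneArc≥ : ∀ {x y} → adj x y ≡ true → 1 over (8 ℕ.* (deg G x ⊔ deg G y)) ≤ Pr G (LoneArc x y)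
  Pr-LoneArc≥ {x} {y} xy with adj⇒deg-suc (trans (adj-sym y x) xy)
  ... | _ , dy = begin
    1 over (8 ℕ.* m)                                   ≡⟨ 1/[8*m]≡1/[2*m]*[½*½] m ⟩
    (1 over (2 ℕ.* m)) * (½ * ½)
      ≤⟨ *-monoˡ-≤-nonNeg (1 over (2 ℕ.* m)) {{nonNegative (0≤over 1 (2 ℕ.* m))}}
           (*-monoˡ-≤-nonNeg ½ {{nonNegative (0≤over 1 2)}} (½≤∏-othersPr x dy)) ⟩
    (1 over (2 ℕ.* m)) * (½ * ∏ (othersPr x y))        ≡⟨ cong₂ (λ p q → p * (q * ∏ (othersPr x y))) x-factor y-factor ⟨
    lonePr x y x * (lonePr₁ y * ∏ (othersPr x y))      ≡⟨ cong (lonePr x y x *_) (∏-updateAt y lonePr₁) ⟨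
    lonePr x y x * ∏ lonePr₁                           ≡⟨ ∏-updateAt x (lonePr x y) ⟨
    ∏ (lonePr x y)                                     ≡⟨ Pr-all≡∏ (loneArcTest x y) ⟨
    Pr G (LoneArc x y)                                 ∎
    where
    open ≤-Reasoning
    m = deg G x ⊔ deg G y
    lonePr₁ = updateAt (lonePr x y) x (λ _ → 1ℚ)
    x-factor : lonePr x y x ≡ 1 over (2 ℕ.* m)
    x-factor = trans (Prᵥ-cong x (loneArcTest-x x y)) (Prᵥ-arcTo-adj xy)
    y-factor : lonePr₁ y ≡ ½
    y-factor = trans (updateAt-minimal y x (lonePr x y) (adj⇒≢ xy))
                     (trans (Prᵥ-cong y (loneArcTest-y (adj⇒≢ xy))) (Prᵥ-notInI y))

open import Data.Nat using (_⊔_; _*_)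
open import Data.Rational using (_≤_)
import Data.Nat.Properties as ℕ
import Data.Rational as ℚ
open import Data.Rational.Properties using (+-mono-≤; module ≤-Reasoning)
open Procedure using (isMatching; LoneArc; Pr-LoneArc≥; Pr-LoneArc+Pr-LoneArc≤Pr-inM)
open Fractions using (1/[4*m]≡1/[8*m]+1/[8*m])

lemma8 : (G : Graph) →
    ((ω : Outcome G) → IsMatching G ω) ×
    (∀ u v → Graph.adj G u v ≡ true →
      (1 over (4 * (deg G u ⊔ deg G v))) ≤ Pr G (λ ω → inM G ω u v))
lemma8 G = isMatching G , bound
  where
  open ≤-Reasoning
  bound : ∀ u v → Graph.adj G u v ≡ true → 1 over (4 * (deg G u ⊔ deg G v)) ≤ Pr G (λ ω → inM G ω u v)
  bound u v uv = begin
    1 over (4 * muv)                              ≡⟨ 1/[4*m]≡1/[8*m]+1/[8*m] muv ⟩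
    1 over (8 * muv) ℚ.+ 1 over (8 * muv)         ≡⟨ cong (λ m → 1 over (8 * muv) ℚ.+ 1 over (8 * m)) (ℕ.⊔-comm (deg G u) (deg G v)) ⟩
    1 over (8 * muv) ℚ.+ 1 over (8 * mvu)         ≤⟨ +-mono-≤ (Pr-LoneArc≥ G uv) (Pr-LoneArc≥ G vu) ⟩
    Pr G (LoneArc G u v) ℚ.+ Pr G (LoneArc G v u) ≤⟨ Pr-LoneArc+Pr-LoneArc≤Pr-inM G uv ⟩
    Pr G (λ ω → inM G ω u v)                      ∎
    where
    muv = deg G u ⊔ deg G v
    mvu = deg G v ⊔ deg G u
    vu = trans (Graph.sym G v u) uv
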